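{- Let $t:\rho$ be any term of Gödel's System $\mathrm{T}$ and let $\alpha:\mathbb{N}\to\mathbb{N}$. For every assignment of values to the free variables $x$ of $t$ and to their counterparts $x^\mathrm{b}$ such that $x^\mathrm{b}\ \mathrm{R}^\alpha\ x$ holds for every $x\in\mathrm{FV}(t)$, we have \[ t^\mathrm{b}\ \mathrm{R}^\alpha_\rho\ t. \]
   Context: Gödel's System $\mathrm{T}$: finite types are generated from the base type $\mathbb{N}$ by function types $\sigma\to\tau$. Terms are those of the simply typed lambda calculus (variables, $\lambda$-abstraction, application) extended with constants $0:\mathbb{N}$, $\mathrm{succ}:\mathbb{N}\to\mathbb{N}$ and, for each finite type $\rho$, $\mathrm{rec}_\rho:\rho\to(\mathbb{N}\to\rho\to\rho)\to\mathbb{N}\to\rho$ with $\mathrm{rec}(a)(f)(0)=a$ and $\mathrm{rec}(a)(f)(\mathrm{succ}\,n)=f(n)(\mathrm{rec}(a)(f)(n))$. The $\mathrm{b}$-translation: types are translated by $\mathbb{N}^\mathrm{b}:\equiv(\mathbb{N}\to\mathbb{N})\to\mathbb{N}$ and $(\sigma\to\tau)^\mathrm{b}:\equiv\sigma^\mathrm{b}\to\tau^\mathrm{b}$. Each variable $x:\rho$ is assigned a variable $x^\mathrm{b}:\rho^\mathrm{b}$, and terms are translated by $(x)^\mathrm{b}:\equiv x^\mathrm{b}$, $(\lambda x.u)^\mathrm{b}:\equiv\lambda x^\mathrm{b}.u^\mathrm{b}$, $(fa)^\mathrm{b}:\equiv f^\mathrm{b}a^\mathrm{b}$, $0^\mathrm{b}:\equiv\lambda\alpha.0$,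 $\mathrm{succ}^\mathrm{b}:\equiv\lambda f\alpha.\mathrm{succ}(f\alpha)$, $\mathrm{rec}^\mathrm{b}:\equiv\lambda af.\mathrm{ke}(\mathrm{rec}(a)(\lambda k.f(\lambda\alpha.k)))$, where $\mathrm{ke}_\rho:(\mathbb{N}\to\rho^\mathrm{b})\to\mathbb{N}^\mathrm{b}\to\rho^\mathrm{b}$ is defined by $\mathrm{ke}_\mathbb{N}(g)(f):\equiv\lambda\alpha.g(f\alpha)(\alpha)$ and $\mathrm{ke}_{\sigma\to\tau}(g)(f):\equiv\lambda x.\mathrm{ke}_\tau(\lambda k.g(k)(x))(f)$. For $\alpha:\mathbb{N}\to\mathbb{N}$ the relation $\mathrm{R}^\alpha_\rho\subseteq\rho^\mathrm{b}\times\rho$ is defined by: $f\ \mathrm{R}^\alpha_\mathbb{N}\ n$ iff $f(\alpha)=n$; and $g\ \mathrm{R}^\alpha_{\sigma\to\tau}\ h$ iff for all $x:\sigma^\mathrm{b}$, $y:\sigma$, $x\ \mathrm{R}^\alpha_\sigma\ y$ implies $g(x)\ \mathrm{R}^\alpha_\tau\ h(y)$. -}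

module Defs where

open import Data.Nat using (ℕ; zero; suc)
open import Data.List using (List; []; _∷_)
open import Relation.Binary.PropositionalEquality using (_≡_)

infixr 7 _⇒_
infix 4 _∋_

data Ty : Set where
  ι   : Ty
  _⇒_ : Ty → Ty → Ty

Ctx : Set
Ctx = List Ty

data _∋_ : Ctx → Ty → Set where
  here  : ∀ {Γ A} → (A ∷ Γ) ∋ A
  there : ∀ {Γ A B} → Γ ∋ A → (B ∷ Γ) ∋ A

data Tm (Γ : Ctx) : Ty → Set where
  var   : ∀ {A} → Γ ∋ A → Tm Γ A
  lam   : ∀ {A B} → Tm (A ∷ Γ) B → Tm Γ (A ⇒ B)
  app   : ∀ {A B} → Tm Γ (A ⇒ B) → Tm Γ A → Tm Γ B
  zer   : Tm Γ ι
  succ  : Tm Γ (ι ⇒ ι)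
  rec   : ∀ ρ → Tm Γ (ρ ⇒ (ι ⇒ ρ ⇒ ρ) ⇒ ι ⇒ ρ)

-- Renaming (needed to use the closed terms ke inside any context)
Ren : Ctx → Ctx → Set
Ren Γ Δ = ∀ {A} → Γ ∋ A → Δ ∋ A

extR : ∀ {Γ Δ B} → Ren Γ Δ → Ren (B ∷ Γ) (B ∷ Δ)
extR r here      = here
extR r (there x) = there (r x)

rename : ∀ {Γ Δ A} → Ren Γ Δ → Tm Γ A → Tm Δ A
rename r (var x)   = var (r x)
rename r (lam t)   = lam (rename (extR r) t)
rename r (app t u) = app (rename r t) (rename r u)
rename r zer       = zer
rename r succ      = succ
rename r (rec ρ)   = rec ρ

fromClosed : ∀ {Γ A} → Tm [] A → Tm Γ A
fromClosed = rename (λ ())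

⟦_⟧ : Ty → Set
⟦ ι ⟧     = ℕ
⟦ A ⇒ B ⟧ = ⟦ A ⟧ → ⟦ B ⟧

Env : Ctx → Set
Env Γ = ∀ {A} → Γ ∋ A → ⟦ A ⟧

_,,_ : ∀ {Γ A} → Env Γ → ⟦ A ⟧ → Env (A ∷ Γ)
(η ,, a) here      = a
(η ,, a) (there x) = η x

recℕ : ∀ {X : Set} → X → (ℕ → X → X) → ℕ → X
recℕ a f zero    = a
recℕ a f (suc n) = f n (recℕ a f n)

eval : ∀ {Γ A} → Tm Γ A → Env Γ → ⟦ A ⟧
eval (var x)   η = η x
eval (lam t)   η = λ a → eval t (η ,, a)
eval (app t u) η = eval t η (eval u η)
eval zer       η = zero
eval succ      η = suc
eval (rec ρ)   η = recℕ

_ᵇ : Ty → Ty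
ι ᵇ       = (ι ⇒ ι) ⇒ ι
(A ⇒ B) ᵇ = A ᵇ ⇒ B ᵇ

_ᵇᶜ : Ctx → Ctx
[] ᵇᶜ      = []
(A ∷ Γ) ᵇᶜ = A ᵇ ∷ Γ ᵇᶜ

varᵇ : ∀ {Γ A} → Γ ∋ A → Γ ᵇᶜ ∋ A ᵇ
varᵇ here      = here
varᵇ (there x) = there (varᵇ x)

-- ke_ρ : (ℕ → ρᵇ) → ℕᵇ → ρᵇ
--   ke_ℕ(g)(f) = λα. g(fα)(α)
--   ke_{σ→τ}(g)(f) = λx. ke_τ(λk. g(k)(x))(f)
ke : ∀ ρ → Tm [] ((ι ⇒ ρ ᵇ) ⇒ ι ᵇ ⇒ ρ ᵇ)
ke ι       = lam (lam (lam (app (app (var (there (there here)))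
                                      (app (var (there here)) (var here)))
                                 (var here))))
ke (σ ⇒ τ) = lam (lam (lam (app (app (fromClosed (ke τ))
                                      (lam (app (app (var (there (there (there here))))
                                                     (var here))
                                                (var (there here)))))
                                 (var (there here)))))

_ᵗ : ∀ {Γ A} → Tm Γ A → Tm (Γ ᵇᶜ) (A ᵇ)
var x ᵗ   = var (varᵇ x)
lam t ᵗ   = lam (t ᵗ)
app t u ᵗ = app (t ᵗ) (u ᵗ)
zer ᵗ     = lam zer
succ ᵗ    = lam (lam (app succ (app (var (there here)) (var here))))
-- recᵇ = λ a f. ke (rec a (λ k. f (λ α. k)))
rec ρ ᵗ   = lam (lam (app (fromClosed (ke ρ))
                          (app (app (rec (ρ ᵇ)) (var (there here)))
                               (lam (app (var (there here)) (lam (var (there here))))))))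

data Occurs {Γ A} (x : Γ ∋ A) : ∀ {B} → Tm Γ B → Set where
  occ-var  : Occurs x (var x)
  occ-lam  : ∀ {C D} {t : Tm (C ∷ Γ) D} → Occurs (there x) t → Occurs x (lam t)
  occ-appˡ : ∀ {C D} {t : Tm Γ (C ⇒ D)} {u : Tm Γ C} → Occurs x t → Occurs x (app t u)
  occ-appʳ : ∀ {C D} {t : Tm Γ (C ⇒ D)} {u : Tm Γ C} → Occurs x u → Occurs x (app t u)

R : (ℕ → ℕ) → ∀ ρ → ⟦ ρ ᵇ ⟧ → ⟦ ρ ⟧ → Set
R α ι       f n = f α ≡ n
R α (σ ⇒ τ) g h = ∀ (x : ⟦ σ ᵇ ⟧) (y : ⟦ σ ⟧) → R α σ x y → R α τ (g x) (h y)

-- All cases are immediate except rec: there the realiser rec(a)(λk. f(λα. k))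
-- is an ℕ-indexed family related pointwise to the values of rec, and ke turns such a
-- family into a realiser at the argument f by evaluating f at α — which R^α_ℕ says is
-- exactly the argument n of the recursion.
module Submission where

open import Data.List using ([]; _∷_)
open import Data.Nat using (ℕ; zero; suc)
open import Function using (_∘_)
open import Relation.Binary.PropositionalEquality

open import Defs

extR-cong : ∀ {Γ Δ B} {r s : Ren Γ Δ} → (∀ {A} (x : Γ ∋ A) → r x ≡ s x) →
            ∀ {A} (x : B ∷ Γ ∋ A) → extR r x ≡ extR s x
extR-cong r≗s here      = refl
extR-cong r≗s (there x) = cong there (r≗s x)

rename-cong : ∀ {Γ Δ A} {r s : Ren Γ Δ} → (∀ {B} (x : Γ ∋ B) → r x ≡ s x) →
              (t : Tm Γ A) → rename r t ≡ rename s t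
rename-cong r≗s (var x)   = cong var (r≗s x)
rename-cong r≗s (lam t)   = cong lam (rename-cong (extR-cong r≗s) t)
rename-cong r≗s (app t u) = cong₂ app (rename-cong r≗s t) (rename-cong r≗s u)
rename-cong r≗s zer       = refl
rename-cong r≗s succ      = refl
rename-cong r≗s (rec ρ)   = refl

extR-∘ : ∀ {Γ Δ Θ B} (r : Ren Δ Θ) (s : Ren Γ Δ) →
         ∀ {A} (x : B ∷ Γ ∋ A) → extR r (extR s x) ≡ extR (r ∘ s) x
extR-∘ r s here      = refl
extR-∘ r s (there x) = refl

rename-∘ : ∀ {Γ Δ Θ A} (r : Ren Δ Θ) (s : Ren Γ Δ) (t : Tm Γ A) →
           rename r (rename s t) ≡ rename (r ∘ s) t
rename-∘ r s (var x)   = refl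
rename-∘ r s (lam t)   =
  cong lam (trans (rename-∘ (extR r) (extR s) t) (rename-cong (extR-∘ r s) t))
rename-∘ r s (app t u) = cong₂ app (rename-∘ r s t) (rename-∘ r s u)
rename-∘ r s zer       = refl
rename-∘ r s succ      = refl
rename-∘ r s (rec ρ)   = refl

module _ (α : ℕ → ℕ) where

  -- ke (σ ⇒ τ) contains ke τ under a renaming, hence the generalisation over r.
  ke-R : ∀ ρ {Δ} (r : Ren [] Δ) (η : Env Δ)
         (g : ℕ → ⟦ ρ ᵇ ⟧) (G : ℕ → ⟦ ρ ⟧) (f : ⟦ ι ᵇ ⟧) (n : ℕ) →
         (∀ k → R α ρ (g k) (G k)) → R α ι f n →
         R α ρ (eval (rename r (ke ρ)) η g f) (G n)
  ke-R ι       r η g G f n gRG refl = gRG (f α)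
  ke-R (σ ⇒ τ) r η g G f n gRG fRn x y xRy =
    subst (λ k → R α τ (k (λ m → g m x) f) (G n y))
          (cong (λ t → eval t _) (sym (rename-∘ _ _ (ke τ))))
          (ke-R τ _ _ (λ m → g m x) (λ m → G m y) f n (λ m → gRG m x y xRy) fRn)

  recℕ-R : ∀ ρ (a : ⟦ ρ ᵇ ⟧) (a′ : ⟦ ρ ⟧) (f : ⟦ (ι ⇒ ρ ⇒ ρ) ᵇ ⟧) (f′ : ⟦ ι ⇒ ρ ⇒ ρ ⟧) →
           R α ρ a a′ → R α (ι ⇒ ρ ⇒ ρ) f f′ →
           ∀ k → R α ρ (recℕ a (λ m → f (λ _ → m)) k) (recℕ a′ f′ k)
  recℕ-R ρ a a′ f f′ aRa′ fRf′ zero    = aRa′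
  recℕ-R ρ a a′ f f′ aRa′ fRf′ (suc k) =
    fRf′ (λ _ → k) k refl _ _ (recℕ-R ρ a a′ f f′ aRa′ fRf′ k)

lemma2p3 : ∀ {Γ : Ctx} {ρ : Ty} (t : Tm Γ ρ) (α : ℕ → ℕ)
    (η : Env Γ) (ηᵇ : Env (Γ ᵇᶜ)) →
    (∀ {A : Ty} (x : Γ ∋ A) → Occurs x t → R α A (ηᵇ (varᵇ x)) (η x)) →
    R α ρ (eval (t ᵗ) ηᵇ) (eval t η)
lemma2p3 (var x)   α η ηᵇ ηRη = ηRη x occ-var
lemma2p3 (lam t)   α η ηᵇ ηRη x y xRy = lemma2p3 t α (η ,, y) (ηᵇ ,, x) extended
  where
  extended : ∀ {A} (v : _ ∋ A) → Occurs v t → R α A ((ηᵇ ,, x) (varᵇ v)) ((η ,, y) v)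
  extended here      _ = xRy
  extended (there v) o = ηRη v (occ-lam o)
lemma2p3 (app t u) α η ηᵇ ηRη =
  lemma2p3 t α η ηᵇ (λ x o → ηRη x (occ-appˡ o)) _ _
           (lemma2p3 u α η ηᵇ (λ x o → ηRη x (occ-appʳ o)))
lemma2p3 zer       α η ηᵇ ηRη = refl
lemma2p3 succ      α η ηᵇ ηRη f n fRn = cong suc fRn
lemma2p3 (rec ρ)   α η ηᵇ ηRη a a′ aRa′ f f′ fRf′ m n mRn =
  ke-R α ρ _ _ _ (recℕ a′ f′) m n (recℕ-R α ρ a a′ f f′ aRa′ fRf′) mRn
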